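{- Let $\mathbf{L}$ be a tense ICRDL-algebra and let $\gamma$ be a congruence of the tense DRL-algebra $K(\mathbf{L})$. Define $\theta^\gamma$ on $L$ by $(a,b)\in\theta^\gamma$ iff $(a,0)\,\gamma\,(b,0)$. Then $\theta^\gamma$ is a congruence of $\mathbf{L}$.
   Context: An ICRDL-algebra is a structure $\langle L,\vee,\wedge,\cdot,\to,0,1\rangle$ such that $\langle L,\vee,\wedge,0,1\rangle$ is a bounded distributive lattice, $\langle L,\cdot,1\rangle$ is a commutative monoid, and $x\cdot y\le z$ iff $x\le y\to z$. A tense ICRDL-algebra is an ICRDL-algebra with unary operations $G,H,F,P$ satisfying: (T1) $P(x)\le y$ iff $x\le G(y)$; (T2) $F(x)\le y$ iff $x\le H(y)$; (T3) $G(0)=0$, $H(0)=0$; (T4) $G(x)\cdot F(y)\le F(x\cdot y)$ and $H(x)\cdot P(y)\le P(x\cdot y)$; (T5) $G(x\vee y)\le G(x)\vee F(y)$ and $H(x\vee y)\le H(x)\vee P(y)$; (T6) $G(x\to y)\le G(x)\to G(y)$ and $H(x\to y)\le H(x)\to H(y)$. Congruences are with respect to all these operations. $K(\mathbf{L})$ is the algebra on $K(L)=\{(a,b)\in L\times L:a\cdot b=0\}$ with $(a,b)\vee(x,y)=(a\vee x,b\wedge y)$, $(a,b)\wedge(x,y)=(a\wedge x,b\vee y)$, $(a,b)\ast(x,y)=(a\cdot x,(a\to y)\wedge(x\to b))$, $(a,b)\Rightarrow(x,y)=((a\to x)\wedge(y\to b),a\cdot y)$, $\sim(a,b)=(b,a)$,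 $0=(0,1)$, $1=(1,0)$, $c=(0,0)$, $G_K(a,b)=(G(a),F(b))$, $H_K(a,b)=(H(a),P(b))$. -}

module Defs where

open import Level using (Level; suc; _⊔_)
open import Data.Product using (_×_; _,_; proj₁; proj₂)
open import Relation.Binary.PropositionalEquality using (_≡_)
open import Relation.Binary.Core using (Rel)
open import Relation.Binary.Structures using (IsEquivalence)

record TenseICRDL (c : Level) : Set (suc c) where
  infixr 6 _∨_
  infixr 7 _∧_
  infixr 8 _·_
  infixr 5 _⇒_
  infix 4 _≤_
  field
    Carrier : Set c
    _∨_ _∧_ _·_ _⇒_ : Carrier → Carrier → Carrier
    𝟘 𝟙 : Carrier
    G H F P : Carrier → Carrier

  _≤_ : Carrier → Carrier → Set c
  x ≤ y = x ∧ y ≡ x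

  field
    ∨-comm  : ∀ x y → x ∨ y ≡ y ∨ x
    ∧-comm  : ∀ x y → x ∧ y ≡ y ∧ x
    ∨-assoc : ∀ x y z → (x ∨ y) ∨ z ≡ x ∨ (y ∨ z)
    ∧-assoc : ∀ x y z → (x ∧ y) ∧ z ≡ x ∧ (y ∧ z)
    ∨-absorbs-∧ : ∀ x y → x ∨ (x ∧ y) ≡ x
    ∧-absorbs-∨ : ∀ x y → x ∧ (x ∨ y) ≡ x
    ∧-distrib-∨ : ∀ x y z → x ∧ (y ∨ z) ≡ (x ∧ y) ∨ (x ∧ z)
    𝟘-least : ∀ x → 𝟘 ≤ x
    𝟙-greatest : ∀ x → x ≤ 𝟙
    ·-assoc : ∀ x y z → (x · y) · z ≡ x · (y · z)
    ·-comm  : ∀ x y → x · y ≡ y · x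
    ·-identityˡ : ∀ x → 𝟙 · x ≡ x
    resid₁ : ∀ x y z → x · y ≤ z → x ≤ y ⇒ z
    resid₂ : ∀ x y z → x ≤ y ⇒ z → x · y ≤ z
    T1₁ : ∀ x y → P x ≤ y → x ≤ G y
    T1₂ : ∀ x y → x ≤ G y → P x ≤ y
    T2₁ : ∀ x y → F x ≤ y → x ≤ H y
    T2₂ : ∀ x y → x ≤ H y → F x ≤ y
    T3G : G 𝟘 ≡ 𝟘
    T3H : H 𝟘 ≡ 𝟘
    T4G : ∀ x y → G x · F y ≤ F (x · y)
    T4H : ∀ x y → H x · P y ≤ P (x · y)
    T5G : ∀ x y → G (x ∨ y) ≤ G x ∨ F y
    T5H : ∀ x y → H (x ∨ y) ≤ H x ∨ P y
    T6G : ∀ x y → G (x ⇒ y) ≤ G x ⇒ G y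
    T6H : ∀ x y → H (x ⇒ y) ≤ H x ⇒ H y

module _ {c : Level} (L : TenseICRDL c) where
  open TenseICRDL L

  -- Congruence of L (w.r.t. all operations; constants are trivially compatible).
  record IsCongruence {ℓ : Level} (θ : Rel Carrier ℓ) : Set (c ⊔ ℓ) where
    field
      isEquivalence : IsEquivalence θ
      ∨-cong : ∀ {a b x y} → θ a b → θ x y → θ (a ∨ x) (b ∨ y)
      ∧-cong : ∀ {a b x y} → θ a b → θ x y → θ (a ∧ x) (b ∧ y)
      ·-cong : ∀ {a b x y} → θ a b → θ x y → θ (a · x) (b · y)
      ⇒-cong : ∀ {a b x y} → θ a b → θ x y → θ (a ⇒ x) (b ⇒ y)
      G-cong : ∀ {a b} → θ a b → θ (G a) (G b)
      H-cong : ∀ {a b} → θ a b → θ (H a) (H b)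
      F-cong : ∀ {a b} → θ a b → θ (F a) (F b)
      P-cong : ∀ {a b} → θ a b → θ (P a) (P b)

  -- The algebra K(L). Its universe is the subset K(L) = {(a,b) | a·b = 0} of L × L;
  -- operations are given on all of L × L (they preserve K(L)).
  Pair : Set c
  Pair = Carrier × Carrier

  InK : Pair → Set c
  InK (a , b) = a · b ≡ 𝟘

  _∨K_ _∧K_ _∗K_ _⇒K_ : Pair → Pair → Pair
  (a , b) ∨K (x , y) = (a ∨ x , b ∧ y)
  (a , b) ∧K (x , y) = (a ∧ x , b ∨ y)
  (a , b) ∗K (x , y) = (a · x , (a ⇒ y) ∧ (x ⇒ b))
  (a , b) ⇒K (x , y) = ((a ⇒ x) ∧ (y ⇒ b) , a · y)

  ∼K : Pair → Pair
  ∼K (a , b) = (b , a)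

  GK HK : Pair → Pair
  GK (a , b) = (G a , F b)
  HK (a , b) = (H a , P b)

  -- A congruence of the tense DRL-algebra K(L): a relation on the subset K(L)
  -- (only its restriction to K(L) matters) that is an equivalence relation on K(L)
  -- and is compatible with ∨, ∧, ∗, ⇒, ∼, G_K, H_K (constants 0, 1, c trivially).
  record IsKCongruence {ℓ : Level} (γ : Rel Pair ℓ) : Set (c ⊔ ℓ) where
    field
      refl  : ∀ {p} → InK p → γ p p
      sym   : ∀ {p q} → InK p → InK q → γ p q → γ q p
      trans : ∀ {p q r} → InK p → InK q → InK r → γ p q → γ q r → γ p r
      ∨-cong : ∀ {p q r s} → InK p → InK q → InK r → InK s →
               γ p q → γ r s → γ (p ∨K r) (q ∨K s)
      ∧-cong : ∀ {p q r s} → InK p → InK q → InK r → InK s →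
               γ p q → γ r s → γ (p ∧K r) (q ∧K s)
      ∗-cong : ∀ {p q r s} → InK p → InK q → InK r → InK s →
               γ p q → γ r s → γ (p ∗K r) (q ∗K s)
      ⇒-cong : ∀ {p q r s} → InK p → InK q → InK r → InK s →
               γ p q → γ r s → γ (p ⇒K r) (q ⇒K s)
      ∼-cong : ∀ {p q} → InK p → InK q → γ p q → γ (∼K p) (∼K q)
      G-cong : ∀ {p q} → InK p → InK q → γ p q → γ (GK p) (GK q)
      H-cong : ∀ {p q} → InK p → InK q → γ p q → γ (HK p) (HK q)

  θ^ : {ℓ : Level} → Rel Pair ℓ → Rel Carrier ℓ
  θ^ γ a b = γ (a , 𝟘) (b , 𝟘)

{-# OPTIONS --safe #-}
module Submission where

open import Defs
open import Level using (Level)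
open import Relation.Binary.Core using (Rel)
open import Relation.Binary.PropositionalEquality
  using (_≡_; sym; trans; cong; cong₂; subst; subst₂; module ≡-Reasoning)
open import Data.Product using (_,_)

-- Every operation of L is the restriction, along a ↦ (a , 0), of a term
-- operation of K(L): the lattice operations and ⇒ directly, the product as
-- (a , 0) ∗ (x , 0) ∨ c with the constant c = (0 , 0), and F, P as ∼ G ∼ and
-- ∼ H ∼.

module TenseICRDLProperties {c : Level} (L : TenseICRDL c) where
  open TenseICRDL L
  open ≡-Reasoning

  ∧-zeroˡ : ∀ x → 𝟘 ∧ x ≡ 𝟘
  ∧-zeroˡ = 𝟘-least

  ∧-zeroʳ : ∀ x → x ∧ 𝟘 ≡ 𝟘
  ∧-zeroʳ x = trans (∧-comm x 𝟘) (∧-zeroˡ x)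

  ∧-idem : ∀ x → x ∧ x ≡ x
  ∧-idem x = begin
    x ∧ x             ≡⟨ cong (x ∧_) (sym (∨-absorbs-∧ x x)) ⟩
    x ∧ (x ∨ x ∧ x)   ≡⟨ ∧-absorbs-∨ x (x ∧ x) ⟩
    x                 ∎

  ∨-identityʳ : ∀ x → x ∨ 𝟘 ≡ x
  ∨-identityʳ x = trans (cong (x ∨_) (sym (∧-zeroʳ x))) (∨-absorbs-∧ x 𝟘)

  x∧y≤y : ∀ x y → x ∧ y ≤ y
  x∧y≤y x y = trans (∧-assoc x y y) (cong (x ∧_) (∧-idem y))

  x≤𝟘⇒x≡𝟘 : ∀ {x} → x ≤ 𝟘 → x ≡ 𝟘
  x≤𝟘⇒x≡𝟘 {x} x≤𝟘 = trans (sym x≤𝟘) (∧-zeroʳ x)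

  𝟙≤x⇒x≡𝟙 : ∀ {x} → 𝟙 ≤ x → x ≡ 𝟙
  𝟙≤x⇒x≡𝟙 {x} 𝟙≤x = trans (sym (𝟙-greatest x)) (trans (∧-comm x 𝟙) 𝟙≤x)

  ·-zeroˡ : ∀ x → 𝟘 · x ≡ 𝟘
  ·-zeroˡ x = x≤𝟘⇒x≡𝟘 (resid₂ 𝟘 x 𝟘 (𝟘-least (x ⇒ 𝟘)))

  ·-zeroʳ : ∀ x → x · 𝟘 ≡ 𝟘
  ·-zeroʳ x = trans (·-comm x 𝟘) (·-zeroˡ x)

  𝟘⇒𝟘≡𝟙 : 𝟘 ⇒ 𝟘 ≡ 𝟙
  𝟘⇒𝟘≡𝟙 = 𝟙≤x⇒x≡𝟙 (resid₁ 𝟙 𝟘 𝟘 (subst (_≤ 𝟘) (sym (·-zeroʳ 𝟙)) (∧-idem 𝟘)))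

  F-𝟘 : F 𝟘 ≡ 𝟘
  F-𝟘 = x≤𝟘⇒x≡𝟘 (T2₂ 𝟘 𝟘 (𝟘-least (H 𝟘)))

  P-𝟘 : P 𝟘 ≡ 𝟘
  P-𝟘 = x≤𝟘⇒x≡𝟘 (T1₂ 𝟘 𝟘 (𝟘-least (G 𝟘)))

module KProperties {c : Level} (L : TenseICRDL c) where
  open TenseICRDL L
  open TenseICRDLProperties L
  open ≡-Reasoning

  ι : Carrier → Pair L
  ι a = (a , 𝟘)

  cK : Pair L
  cK = (𝟘 , 𝟘)

  ι∈K : ∀ a → InK L (ι a)
  ι∈K = ·-zeroʳ

  cK∈K : InK L cK
  cK∈K = ·-zeroˡ 𝟘

  ∼K∈K : ∀ {p} → InK L p → InK L (∼K L p)
  ∼K∈K {a , b} ab≡𝟘 = trans (·-comm b a) ab≡𝟘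

  GK∈K : ∀ {p} → InK L p → InK L (GK L p)
  GK∈K {a , b} ab≡𝟘 = x≤𝟘⇒x≡𝟘 (subst (G a · F b ≤_) F[ab]≡𝟘 (T4G a b))
    where
    F[ab]≡𝟘 : F (a · b) ≡ 𝟘
    F[ab]≡𝟘 = trans (cong F ab≡𝟘) F-𝟘

  HK∈K : ∀ {p} → InK L p → InK L (HK L p)
  HK∈K {a , b} ab≡𝟘 = x≤𝟘⇒x≡𝟘 (subst (H a · P b ≤_) P[ab]≡𝟘 (T4H a b))
    where
    P[ab]≡𝟘 : P (a · b) ≡ 𝟘
    P[ab]≡𝟘 = trans (cong P ab≡𝟘) P-𝟘

  ι∗ι∈K : ∀ a x → InK L (_∗K_ L (ι a) (ι x))
  ι∗ι∈K a x = begin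
    (a · x) · m   ≡⟨ ·-assoc a x m ⟩
    a · (x · m)   ≡⟨ cong (a ·_) xm≡𝟘 ⟩
    a · 𝟘         ≡⟨ ·-zeroʳ a ⟩
    𝟘             ∎
    where
    m = (a ⇒ 𝟘) ∧ (x ⇒ 𝟘)
    xm≡𝟘 : x · m ≡ 𝟘
    xm≡𝟘 = trans (·-comm x m) (x≤𝟘⇒x≡𝟘 (resid₂ m x 𝟘 (x∧y≤y (a ⇒ 𝟘) (x ⇒ 𝟘))))

  ι-∨ : ∀ a x → _∨K_ L (ι a) (ι x) ≡ ι (a ∨ x)
  ι-∨ a x = cong (a ∨ x ,_) (∧-zeroˡ 𝟘)

  ι-∧ : ∀ a x → _∧K_ L (ι a) (ι x) ≡ ι (a ∧ x)
  ι-∧ a x = cong (a ∧ x ,_) (∨-identityʳ 𝟘)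

  ι-⇒ : ∀ a x → _⇒K_ L (ι a) (ι x) ≡ ι (a ⇒ x)
  ι-⇒ a x = cong₂ _,_ (trans (cong ((a ⇒ x) ∧_) 𝟘⇒𝟘≡𝟙) (𝟙-greatest (a ⇒ x))) (·-zeroʳ a)

  ι-· : ∀ a x → _∨K_ L (_∗K_ L (ι a) (ι x)) cK ≡ ι (a · x)
  ι-· a x = cong₂ _,_ (∨-identityʳ (a · x)) (∧-zeroʳ ((a ⇒ 𝟘) ∧ (x ⇒ 𝟘)))

  ι-G : ∀ a → GK L (ι a) ≡ ι (G a)
  ι-G a = cong (G a ,_) F-𝟘

  ι-H : ∀ a → HK L (ι a) ≡ ι (H a)
  ι-H a = cong (H a ,_) P-𝟘

  ι-F : ∀ a → ∼K L (GK L (∼K L (ι a))) ≡ ι (F a)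
  ι-F a = cong (F a ,_) T3G

  ι-P : ∀ a → ∼K L (HK L (∼K L (ι a))) ≡ ι (P a)
  ι-P a = cong (P a ,_) T3H

module Restriction {c ℓ : Level} (L : TenseICRDL c) (γ : Rel (Pair L) ℓ)
                   (K : IsKCongruence L γ) where
  open TenseICRDL L
  open KProperties L
  module γ = IsKCongruence K

  θ : Rel Carrier ℓ
  θ = θ^ L γ

  restrict₁ : (f : Pair L → Pair L) (g : Carrier → Carrier) →
              (∀ a → f (ι a) ≡ ι (g a)) →
              (∀ {a b} → θ a b → γ (f (ι a)) (f (ι b))) →
              ∀ {a b} → θ a b → θ (g a) (g b)
  restrict₁ f g f-ι f-cong θab = subst₂ γ (f-ι _) (f-ι _) (f-cong θab)

  restrict₂ : (f : Pair L → Pair L → Pair L) (g : Carrier → Carrier → Carrier) →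
              (∀ a x → f (ι a) (ι x) ≡ ι (g a x)) →
              (∀ {a b x y} → θ a b → θ x y → γ (f (ι a) (ι x)) (f (ι b) (ι y))) →
              ∀ {a b x y} → θ a b → θ x y → θ (g a x) (g b y)
  restrict₂ f g f-ι f-cong θab θxy = subst₂ γ (f-ι _ _) (f-ι _ _) (f-cong θab θxy)

  ι∗ι∨cK-cong : ∀ {a b x y} → θ a b → θ x y →
                γ (_∨K_ L (_∗K_ L (ι a) (ι x)) cK) (_∨K_ L (_∗K_ L (ι b) (ι y)) cK)
  ι∗ι∨cK-cong θab θxy =
    γ.∨-cong (ι∗ι∈K _ _) (ι∗ι∈K _ _) cK∈K cK∈K
      (γ.∗-cong (ι∈K _) (ι∈K _) (ι∈K _) (ι∈K _) θab θxy) (γ.refl cK∈K)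

  ∼G∼ι-cong : ∀ {a b} → θ a b → γ (∼K L (GK L (∼K L (ι a)))) (∼K L (GK L (∼K L (ι b))))
  ∼G∼ι-cong θab =
    γ.∼-cong (GK∈K (∼K∈K (ι∈K _))) (GK∈K (∼K∈K (ι∈K _)))
      (γ.G-cong (∼K∈K (ι∈K _)) (∼K∈K (ι∈K _)) (γ.∼-cong (ι∈K _) (ι∈K _) θab))

  ∼H∼ι-cong : ∀ {a b} → θ a b → γ (∼K L (HK L (∼K L (ι a)))) (∼K L (HK L (∼K L (ι b))))
  ∼H∼ι-cong θab =
    γ.∼-cong (HK∈K (∼K∈K (ι∈K _))) (HK∈K (∼K∈K (ι∈K _)))
      (γ.H-cong (∼K∈K (ι∈K _)) (∼K∈K (ι∈K _)) (γ.∼-cong (ι∈K _) (ι∈K _) θab))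

  θ-isCongruence : IsCongruence L θ
  θ-isCongruence = record
    { isEquivalence = record
      { refl  = γ.refl (ι∈K _)
      ; sym   = γ.sym (ι∈K _) (ι∈K _)
      ; trans = γ.trans (ι∈K _) (ι∈K _) (ι∈K _)
      }
    ; ∨-cong = restrict₂ (_∨K_ L) _∨_ ι-∨ (γ.∨-cong (ι∈K _) (ι∈K _) (ι∈K _) (ι∈K _))
    ; ∧-cong = restrict₂ (_∧K_ L) _∧_ ι-∧ (γ.∧-cong (ι∈K _) (ι∈K _) (ι∈K _) (ι∈K _))
    ; ⇒-cong = restrict₂ (_⇒K_ L) _⇒_ ι-⇒ (γ.⇒-cong (ι∈K _) (ι∈K _) (ι∈K _) (ι∈K _))
    ; ·-cong = restrict₂ (λ p q → _∨K_ L (_∗K_ L p q) cK) _·_ ι-· ι∗ι∨cK-cong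
    ; G-cong = restrict₁ (GK L) G ι-G (γ.G-cong (ι∈K _) (ι∈K _))
    ; H-cong = restrict₁ (HK L) H ι-H (γ.H-cong (ι∈K _) (ι∈K _))
    ; F-cong = restrict₁ (λ p → ∼K L (GK L (∼K L p))) F ι-F ∼G∼ι-cong
    ; P-cong = restrict₁ (λ p → ∼K L (HK L (∼K L p))) P ι-P ∼H∼ι-cong
    }

mainTheorem14 : {c ℓ : Level} (L : TenseICRDL c) (γ : Rel (Pair L) ℓ) →
    IsKCongruence L γ → IsCongruence L (θ^ L γ)
mainTheorem14 = Restriction.θ-isCongruence
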